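{- Fix integers $b\geq 2$ and $N\geq 1$, and define \[ K := \Big\lceil 1 + \log_\varphi(2b^N)\Big\rceil, \qquad n_* := \max\{n\geq 0:\; F_n \leq b^N-1\}. \] Then for every integer $m\geq n_*+K+1$ there is no base-$b$ step appending at most $N$ digits from $F_m$ to a Fibonacci number; that is, there do not exist integers $n\geq 0$, $t$ with $1\leq t\leq N$, and $r$ with $0\leq r<b^t$ such that $F_n = b^t F_m + r$. Consequently, any at-most-$N$-digit-appending walk along the Fibonacci numbers in base $b$ has at most $L$ steps, where \[ L \leq n_* + K \leq 2N\log_\varphi b + \log_\varphi 2 + 4 . \] In particular $L = O(N\log_\varphi b)$ uniformly in the starting term.
   Context: $(F_n)_{n\geq 0}$ denotes the Fibonacci sequence: $F_0=0$, $F_1=1$, $F_{n+1}=F_n+F_{n-1}$. $\varphi=\frac{1+\sqrt5}{2}$. An at-most-$N$-digit-appending walk along the Fibonacci sequence in base $b$ is a finite or infinite sequence $M_0, M_1, M_2,\dots$ with $M_0 = F_m$ a Fibonacci number, such that each $M_j$ is a Fibonacci number and for each step $M_{j+1} = b^t M_j + r$ for some integers $1\leq t\leq N$ and $0\leq r<b^t$ (i.e. between $1$ and $N$ base-$b$ digits, leading zeros allowed, are appended on the right). The number of steps of the walk is the number of such transitions. -}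

module Defs where

open import Data.Nat using (ℕ; zero; suc; _+_; _*_; _∸_; _^_; _≤_; _<_)
open import Data.Product using (Σ; ∃; _×_)
open import Relation.Nullary using (¬_)
open import Relation.Binary.PropositionalEquality using (_≡_)

fib : ℕ → ℕ
fib zero = 0
fib (suc zero) = 1
fib (suc (suc n)) = fib (suc n) + fib n

-- Lucas numbers: L 0 = 2, L 1 = 1, L (n+2) = L (n+1) + L n.
-- They satisfy φ^j = (L j + F j · √5) / 2.
lucas : ℕ → ℕ
lucas zero = 2
lucas (suc zero) = 1
lucas (suc (suc n)) = lucas (suc n) + lucas n

IsFib : ℕ → Set
IsFib x = ∃ λ n → fib n ≡ x

AppendStep : (b N x y : ℕ) → Set
AppendStep b N x y =
  ∃ λ t → 1 ≤ t × t ≤ N × (∃ λ r → r < b ^ t × y ≡ b ^ t * x + r)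

IsWalk : (b N : ℕ) → (M : ℕ → ℕ) → (k : ℕ) → Set
IsWalk b N M k =
  (∃ λ m → 1 ≤ m × M 0 ≡ fib m)
  × (∀ i → i ≤ k → IsFib (M i))
  × (∀ i → i < k → AppendStep b N (M i) (M (suc i)))

-- Exact real comparisons with φ^j, written in integer arithmetic via
-- φ^j = (L j + F j √5)/2 :
-- φ^j ≥ M  ⇔  F j √5 ≥ 2M − L j  ⇔  (2M ∸ L j)² ≤ 5 (F j)²
PhiPowGe : ℕ → ℕ → Set
PhiPowGe j M = (2 * M ∸ lucas j) ^ 2 ≤ 5 * fib j ^ 2

-- φ^j ≤ M  ⇔  F j √5 ≤ 2M − L j  ⇔  L j ≤ 2M and 5 (F j)² ≤ (2M − L j)²
PhiPowLe : ℕ → ℕ → Set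
PhiPowLe j M = lucas j ≤ 2 * M × 5 * fib j ^ 2 ≤ (2 * M ∸ lucas j) ^ 2

-- K = ⌈1 + log_φ (2 b^N)⌉ : K = suc j with j the least natural with φ^j ≥ 2 b^N
-- (the ceiling is ≥ 1 since 2 b^N > 1, so minimising over ℕ is the same as over ℤ)
IsK : (b N K : ℕ) → Set
IsK b N K = Σ ℕ λ j → K ≡ suc j × PhiPowGe j (2 * b ^ N)
                     × (∀ i → i < j → ¬ PhiPowGe i (2 * b ^ N))

IsNStar : (b N ns : ℕ) → Set
IsNStar b N ns = fib ns ≤ b ^ N ∸ 1 × (∀ n → fib n ≤ b ^ N ∸ 1 → n ≤ ns)

{-# OPTIONS --safe #-}
-- Consider a step F_n = c F_m + r with 2 ≤ c ≤ b^N, r < c and m ≥ n* + 3, so that c ≤ F_{m-2},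
-- and write n = m + s.  Since F_{m+s} ≥ F_m F_{s+1}, the step cannot go far: s + 1 < m, so
-- m = a + s with a ≥ 1.  The identity F_{a+2s} + (-1)^s F_a = L_s F_{a+s} exhibits F_n as
-- L_s F_m ∓ F_a, and as r + F_a < F_m, uniqueness of division by F_m forces F_n = L_s F_m + F_a,
-- c = L_s and r = F_a.  Hence F_a < b^N and L_s ≤ b^N < L_j (where K = j + 1 and φ^j ≥ 2 b^N),
-- i.e. a ≤ n* and s < j, so m < n* + j.  Along a walk the Fibonacci index strictly increases,
-- which bounds the number of steps.  Finally L_{p+q+1} = F_{p+1} L_{q+1} + F_p L_q with
-- p = n* - 2 and q = j - 2, where F_{n*} < b^N and L_q, L_{q+1} ≤ 2 b^N by minimality of j,
-- gives L_{n*+K-4} < 2 b^{2N}, while φ^e ≤ L_e + 1.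
module Submission where

open import Defs
open import Data.Empty using (⊥)
open import Data.Nat
  using (ℕ; zero; suc; _+_; _*_; _∸_; _^_; _≤_; _<_; z≤n; s≤s; NonZero; >-nonZero; ≢-nonZero⁻¹)
open import Data.Nat.DivMod using (_%_; [m+kn]%n≡m%n; m<n⇒m%n≡m)
open import Data.Nat.Properties
open import Data.Nat.Tactic.RingSolver using (solve-∀)
open import Data.Product using (∃; ∃₂; _×_; _,_; proj₁; proj₂)
open import Data.Sum using (_⊎_; inj₁; inj₂)
import Data.Sum as Sum
open import Relation.Nullary using (¬_; contradiction)
open import Relation.Binary.PropositionalEquality

infix 4 _≡_±_

_≡_±_ : ℕ → ℕ → ℕ → Set
x ≡ y ± d = x + d ≡ y ⊎ x ≡ y + d

±-sym : ∀ {x y d} → x ≡ y ± d → y ≡ x ± d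
±-sym (inj₁ eq) = inj₂ (sym eq)
±-sym (inj₂ eq) = inj₁ (sym eq)

±-cong : ∀ {x x′ y y′ d} → x ≡ x′ → y ≡ y′ → x ≡ y ± d → x′ ≡ y′ ± d
±-cong refl refl p = p

±-+ˡ : ∀ k {x y d} → x ≡ y ± d → k + x ≡ k + y ± d
±-+ˡ k {x} {y} {d} (inj₁ eq) = inj₁ (trans (+-assoc k x d) (cong (k +_) eq))
±-+ˡ k {x} {y} {d} (inj₂ eq) = inj₂ (trans (cong (k +_) eq) (sym (+-assoc k y d)))

±-*ˡ : ∀ k {x y d} → x ≡ y ± d → k * x ≡ k * y ± k * d
±-*ˡ k {x} {y} {d} (inj₁ eq) = inj₁ (trans (sym (*-distribˡ-+ k x d)) (cong (k *_) eq))
±-*ˡ k {x} {y} {d} (inj₂ eq) = inj₂ (trans (cong (k *_) eq) (*-distribˡ-+ k y d))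

±⇒≤ : ∀ {x y d} → x ≡ y ± d → x ≤ y + d
±⇒≤ {x} {y} {d} (inj₁ eq) = ≤-trans (m≤m+n x d) (≤-trans (≤-reflexive eq) (m≤m+n y d))
±⇒≤ (inj₂ eq) = ≤-reflexive eq

±⇒≥ : ∀ {x y d} → x ≡ y ± d → y ≤ x + d
±⇒≥ p = ±⇒≤ (±-sym p)

FibLike : (ℕ → ℕ) → Set
FibLike G = ∀ n → G (suc (suc n)) ≡ G (suc n) + G n

fibLike-+ : ∀ {G H} → FibLike G → FibLike H → FibLike (λ n → G n + H n)
fibLike-+ {G} {H} g h n =
  trans (cong₂ _+_ (g n) (h n)) (interchange (G (suc n)) (G n) (H (suc n)) (H n))
  where
  interchange : ∀ a b c d → (a + b) + (c + d) ≡ (a + c) + (b + d)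
  interchange = solve-∀

fibLike-*ˡ : ∀ k {G} → FibLike G → FibLike (λ n → k * G n)
fibLike-*ˡ k {G} g n = trans (cong (k *_) (g n)) (*-distribˡ-+ k (G (suc n)) (G n))

fibLike-≡ : ∀ G H → FibLike G → FibLike H → G 0 ≡ H 0 → G 1 ≡ H 1 → ∀ n → G n ≡ H n
fibLike-≡ G H g h G0≡H0 G1≡H1 n = proj₁ (consecutive n)
  where
  consecutive : ∀ n → G n ≡ H n × G (suc n) ≡ H (suc n)
  consecutive zero = G0≡H0 , G1≡H1
  consecutive (suc n) =
    let (eq , eq′) = consecutive n in
    eq′ , trans (g n) (trans (cong₂ _+_ eq′ eq) (sym (h n)))

fibLike-± : ∀ G H D → FibLike G → FibLike H → FibLike D →
            (G 0 + D 0 ≡ H 0 × G 1 + D 1 ≡ H 1) ⊎ (G 0 ≡ H 0 + D 0 × G 1 ≡ H 1 + D 1) →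
            ∀ n → G n ≡ H n ± D n
fibLike-± G H D g h d (inj₁ (eq₀ , eq₁)) n =
  inj₁ (fibLike-≡ (λ n → G n + D n) H (fibLike-+ {G} {D} g d) h eq₀ eq₁ n)
fibLike-± G H D g h d (inj₂ (eq₀ , eq₁)) n =
  inj₂ (fibLike-≡ G (λ n → H n + D n) g (fibLike-+ {H} {D} h d) eq₀ eq₁ n)

fibLike-addition : ∀ G → FibLike G → ∀ m n → G (suc (m + n)) ≡ fib (suc m) * G (suc n) + fib m * G n
fibLike-addition G g m n =
  fibLike-≡ (λ m → G (suc (m + n))) (λ m → fib (suc m) * G (suc n) + fib m * G n)
    (λ m → g (suc (m + n))) recurrence
    (base₀ (G (suc n)) (G n)) (trans (g n) (base₁ (G (suc n)) (G n))) m
  where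
  base₀ : ∀ x y → x ≡ 1 * x + 0 * y
  base₀ = solve-∀
  base₁ : ∀ x y → x + y ≡ 1 * x + 1 * y
  base₁ = solve-∀
  recurrence : FibLike (λ m → fib (suc m) * G (suc n) + fib m * G n)
  recurrence m = distrib (fib (suc (suc m))) (fib (suc m)) (fib m) (G (suc n)) (G n)
    where
    distrib : ∀ x y z a b → (x + y) * a + (y + z) * b ≡ (x * a + y * b) + (y * a + z * b)
    distrib = solve-∀

fib-fibLike : FibLike fib
fib-fibLike _ = refl

lucas-fibLike : FibLike lucas
lucas-fibLike _ = refl

lucas-suc : ∀ n → lucas (suc n) ≡ fib (suc (suc n)) + fib n
lucas-suc = fibLike-≡ (λ n → lucas (suc n)) (λ n → fib (suc (suc n)) + fib n)
  (λ _ → refl) (fibLike-+ {λ n → fib (suc (suc n))} {fib} (λ _ → refl) fib-fibLike) refl refl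

fib-cassini : ∀ n → fib (suc n) * fib (suc n) ≡ fib (suc n) * fib n + fib n * fib n ± 1
fib-cassini zero = inj₂ refl
fib-cassini (suc n) = ±-cong (lhs (fib (suc n)) (fib n)) (rhs (fib (suc n)) (fib n))
  (±-+ˡ (fib (suc n) * fib (suc n) + fib (suc n) * fib n) (±-sym (fib-cassini n)))
  where
  lhs : ∀ q r → (q * q + q * r) + (q * r + r * r) ≡ (q + r) * (q + r)
  lhs = solve-∀
  rhs : ∀ q r → (q * q + q * r) + q * q ≡ (q + r) * q + q * q
  rhs = solve-∀

lucas-cassini : ∀ n → 5 * (fib n * fib n) ≡ lucas n * lucas n ± 4
lucas-cassini zero = inj₁ refl
lucas-cassini (suc n) =
  ±-cong (lhs (fib (suc n)))
         (trans (rhs (fib (suc n)) (fib n)) (cong (λ l → l * l) (sym (lucas-suc n))))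
         (±-+ˡ (fib (suc n) * fib (suc n)) (±-*ˡ 4 (fib-cassini n)))
  where
  lhs : ∀ q → q * q + 4 * (q * q) ≡ 5 * (q * q)
  lhs = solve-∀
  rhs : ∀ q r → q * q + 4 * (q * r + r * r) ≡ ((q + r) + r) * ((q + r) + r)
  rhs = solve-∀

fib-double : ∀ n → fib (n + n) ≡ lucas n * fib n
fib-double zero = refl
fib-double (suc n) = begin
  fib (suc n + suc n)                                    ≡⟨ fibLike-addition fib fib-fibLike n (suc n) ⟩
  fib (suc n) * fib (suc (suc n)) + fib n * fib (suc n)  ≡⟨ factor (fib (suc n)) (fib n) ⟩
  (fib (suc (suc n)) + fib n) * fib (suc n)              ≡⟨ cong (_* fib (suc n)) (lucas-suc n) ⟨
  lucas (suc n) * fib (suc n)                            ∎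
  where
  open ≡-Reasoning
  factor : ∀ q r → q * (q + r) + r * q ≡ ((q + r) + r) * q
  factor = solve-∀

fib-double-suc : ∀ n → fib (suc (n + n)) ≡ lucas n * fib (suc n) ± 1
fib-double-suc zero = inj₁ refl
fib-double-suc (suc n) =
  ±-cong (sym (fibLike-addition fib fib-fibLike (suc n) (suc n)))
         (trans (expand (fib (suc n)) (fib n)) (cong (_* fib (suc (suc n))) (sym (lucas-suc n))))
         (±-+ˡ (fib (suc (suc n)) * fib (suc (suc n))) (fib-cassini n))
  where
  expand : ∀ q r → (q + r) * (q + r) + (q * r + r * r) ≡ ((q + r) + r) * (q + r)
  expand = solve-∀

fib-shift : ∀ s a → fib (a + s + s) ≡ lucas s * fib (a + s) ± fib a
fib-shift s = fibLike-± (λ a → fib (a + s + s)) (λ a → lucas s * fib (a + s)) fib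
  (λ _ → refl) (fibLike-*ˡ (lucas s) (λ _ → refl)) fib-fibLike
  (Sum.map (trans (+-identityʳ _) (fib-double s) ,_) (trans (fib-double s) (sym (+-identityʳ _)) ,_)
           (fib-double-suc s))

stepwise-mono : ∀ (f : ℕ → ℕ) → (∀ n → f n ≤ f (suc n)) → ∀ {m n} → m ≤ n → f m ≤ f n
stepwise-mono f step {n = zero} z≤n = ≤-refl
stepwise-mono f step {n = suc n} m≤1+n with m≤n⇒m<n∨m≡n m≤1+n
... | inj₁ (s≤s m≤n) = ≤-trans (stepwise-mono f step m≤n) (step n)
... | inj₂ refl = ≤-refl

stepwise-reflects-< : ∀ (f : ℕ → ℕ) → (∀ n → f n ≤ f (suc n)) → ∀ {m n} → f m < f n → m < n
stepwise-reflects-< f step fm<fn = ≰⇒> (λ n≤m → <⇒≱ fm<fn (stepwise-mono f step n≤m))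

fib-≤-suc : ∀ n → fib n ≤ fib (suc n)
fib-≤-suc zero = z≤n
fib-≤-suc (suc n) = m≤m+n (fib (suc n)) (fib n)

fib-mono : ∀ {m n} → m ≤ n → fib m ≤ fib n
fib-mono = stepwise-mono fib fib-≤-suc

fib-<⇒< : ∀ {m n} → fib m < fib n → m < n
fib-<⇒< = stepwise-reflects-< fib fib-≤-suc

fib-suc-pos : ∀ n → 1 ≤ fib (suc n)
fib-suc-pos n = fib-mono {1} {suc n} (s≤s z≤n)

lucas-<⇒< : ∀ {m n} → 1 ≤ n → lucas m < lucas n → m < n
lucas-<⇒< {zero} 1≤n _ = 1≤n
lucas-<⇒< {suc m} {suc n} _ Lm<Ln =
  s≤s (stepwise-reflects-< (λ n → lucas (suc n)) (λ n → m≤m+n (lucas (suc n)) (lucas n)) Lm<Ln)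

2<lucas⇒2≤ : ∀ {n} → 2 < lucas n → 2 ≤ n
2<lucas⇒2≤ {zero} (s≤s (s≤s ()))
2<lucas⇒2≤ {suc zero} (s≤s ())
2<lucas⇒2≤ {suc (suc n)} _ = s≤s (s≤s z≤n)

fib-*-≤ : ∀ m n → fib m * fib (suc n) ≤ fib (m + n)
fib-*-≤ zero n = z≤n
fib-*-≤ (suc m) n = ≤-trans (m≤m+n _ _) (≤-reflexive (sym (fibLike-addition fib fib-fibLike m n)))

quotRem-unique : ∀ {q₁ q₂ r₁ r₂ d} → r₁ < d → r₂ < d → q₁ * d + r₁ ≡ q₂ * d + r₂ →
                 q₁ ≡ q₂ × r₁ ≡ r₂
quotRem-unique {q₁} {q₂} {r₁} {r₂} {d} r₁<d r₂<d eq =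
  *-cancelʳ-≡ q₁ q₂ d (+-cancelʳ-≡ r₁ _ _ eq′) , r₁≡r₂
  where
  instance
    d≢0 : NonZero d
    d≢0 = >-nonZero (≤-<-trans z≤n r₁<d)
  remainder : ∀ {q r} → r < d → (q * d + r) % d ≡ r
  remainder {q} {r} r<d =
    trans (cong (_% d) (+-comm (q * d) r)) (trans ([m+kn]%n≡m%n r q d) (m<n⇒m%n≡m r<d))
  r₁≡r₂ : r₁ ≡ r₂
  r₁≡r₂ = trans (sym (remainder {q₁} r₁<d)) (trans (cong (_% d) eq) (remainder {q₂} r₂<d))
  eq′ : q₁ * d + r₁ ≡ q₂ * d + r₁
  eq′ = trans eq (cong (q₂ * d +_) (sym r₁≡r₂))

±-quotRem : ∀ {c q F r d} → r + d < F → 1 ≤ d → c * F + r ≡ q * F ± d → c ≡ q × r ≡ d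
±-quotRem {c} {q} {F} {r} {d} r+d<F 1≤d (inj₁ eq) =
  contradiction (m+n≡0⇒n≡0 r r+d≡0) (≢-nonZero⁻¹ d ⦃ >-nonZero 1≤d ⦄)
  where
  eq′ : c * F + (r + d) ≡ q * F + 0
  eq′ = trans (sym (+-assoc (c * F) r d)) (trans eq (sym (+-identityʳ (q * F))))
  r+d≡0 : r + d ≡ 0
  r+d≡0 = proj₂ (quotRem-unique {c} {q} r+d<F (≤-<-trans z≤n r+d<F) eq′)
±-quotRem {r = r} r+d<F 1≤d (inj₂ eq) =
  quotRem-unique (≤-<-trans (m≤m+n r _) r+d<F) (≤-<-trans (m≤n+m _ r) r+d<F) eq

<-*-+ : ∀ {c x} r → 2 ≤ c → 1 ≤ x → x < c * x + r
<-*-+ {c} {x} r 2≤c 1≤x = begin-strict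
  x           <⟨ m<m+n x 1≤x ⟩
  x + x       ≡⟨ cong (x +_) (+-identityʳ x) ⟨
  2 * x       ≤⟨ *-monoˡ-≤ x 2≤c ⟩
  c * x       ≤⟨ m≤m+n (c * x) r ⟩
  c * x + r   ∎
  where open ≤-Reasoning

fib-append-gap : ∀ {c m r s} → c < fib m → r < c → fib (m + s) ≡ c * fib m + r → suc s < m
fib-append-gap {c} {m} {r} {s} c<Fm r<c eq =
  ≰⇒> (λ m≤1+s → <-irrefl refl (≤-<-trans (too-big m≤1+s) too-small))
  where
  open ≤-Reasoning
  too-big : m ≤ suc s → fib m * suc c ≤ c * fib m + r
  too-big m≤1+s = begin
    fib m * suc c        ≤⟨ *-monoʳ-≤ (fib m) (≤-trans c<Fm (fib-mono m≤1+s)) ⟩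
    fib m * fib (suc s)  ≤⟨ fib-*-≤ m s ⟩
    fib (m + s)          ≡⟨ eq ⟩
    c * fib m + r        ∎
  too-small : c * fib m + r < fib m * suc c
  too-small = begin-strict
    c * fib m + r        <⟨ +-monoʳ-< (c * fib m) (<-trans r<c c<Fm) ⟩
    c * fib m + fib m    ≡⟨ +-comm (c * fib m) (fib m) ⟩
    suc c * fib m        ≡⟨ *-comm (suc c) (fib m) ⟩
    fib m * suc c        ∎

fib-append-shape : ∀ {c m n r} → 2 ≤ c → c ≤ fib m → r < c → fib n ≡ c * fib (2 + m) + r →
                   ∃₂ λ a s → a + s ≡ 2 + m × c ≡ lucas s × r ≡ fib a
fib-append-shape {c} {m} {n} {r} 2≤c c≤Fm r<c eq = a , s , a+s≡M , ±-quotRem r+Fa<FM 1≤Fa shifted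
  where
  open ≤-Reasoning
  M : ℕ
  M = 2 + m
  c<FM : c < fib M
  c<FM = +-mono-≤ (fib-suc-pos m) c≤Fm
  M<n : M < n
  M<n = fib-<⇒< (subst (fib M <_) (sym eq) (<-*-+ r 2≤c (≤-trans (s≤s z≤n) c<FM)))
  s : ℕ
  s = n ∸ M
  M+s≡n : M + s ≡ n
  M+s≡n = m+[n∸m]≡n (<⇒≤ M<n)
  s<M : s < M
  s<M = <-trans (n<1+n s) (fib-append-gap c<FM r<c (trans (cong fib M+s≡n) eq))
  a : ℕ
  a = M ∸ s
  a+s≡M : a + s ≡ M
  a+s≡M = m∸n+n≡m (<⇒≤ s<M)
  1≤Fa : 1 ≤ fib a
  1≤Fa = fib-mono {1} {a} (m<n⇒0<n∸m s<M)
  a≤1+m : a ≤ suc m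
  a≤1+m = ∸-monoʳ-≤ M (m<n⇒0<n∸m M<n)
  r+Fa<FM : r + fib a < fib M
  r+Fa<FM = begin-strict
    r + fib a           <⟨ +-mono-<-≤ (<-≤-trans r<c c≤Fm) (fib-mono a≤1+m) ⟩
    fib m + fib (suc m) ≡⟨ +-comm (fib m) (fib (suc m)) ⟩
    fib M               ∎
  shifted : c * fib M + r ≡ lucas s * fib M ± fib a
  shifted = ±-cong (trans (cong (λ k → fib (k + s)) a+s≡M) (trans (cong fib M+s≡n) eq))
                   (cong (λ k → lucas s * fib k) a+s≡M)
                   (fib-shift s a)

upper-bound⇒≤fib-suc : ∀ {B ns} → (∀ n → fib n ≤ B ∸ 1 → n ≤ ns) → B ≤ fib (suc ns)
upper-bound⇒≤fib-suc {ns = ns} ns-max = ≮⇒≥ (λ F<B → 1+n≰n (ns-max (suc ns) (<⇒≤pred F<B)))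

fib-append-index-≤ : ∀ {B ns j c m n r} → (∀ x → fib x ≤ B ∸ 1 → x ≤ ns) → B < lucas j →
                     2 ≤ c → c ≤ B → r < c → fib n ≡ c * fib m + r → m ≤ ns + j
fib-append-index-≤ {B} {ns} {j} {c} {m} {n} {r} ns-max B<Lj 2≤c c≤B r<c eq =
  Sum.[ near , far eq ]′ (≤-<-connex m (2 + ns))
  where
  open ≤-Reasoning
  2≤j : 2 ≤ j
  2≤j = 2<lucas⇒2≤ (≤-<-trans (≤-trans 2≤c c≤B) B<Lj)
  near : m ≤ 2 + ns → m ≤ ns + j
  near m≤2+ns = ≤-trans m≤2+ns (≤-trans (≤-reflexive (+-comm 2 ns)) (+-monoʳ-≤ ns 2≤j))
  c≤fib[1+ns+o] : ∀ o → c ≤ fib (suc ns + o)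
  c≤fib[1+ns+o] o =
    ≤-trans c≤B (≤-trans (upper-bound⇒≤fib-suc ns-max) (fib-mono (m≤m+n (suc ns) o)))
  far : ∀ {m′} → fib n ≡ c * fib m′ + r → 2 + ns < m′ → m′ ≤ ns + j
  far eq′ 2+ns<m′ with m≤n⇒∃[o]m+o≡n 2+ns<m′
  ... | o , refl with fib-append-shape {n = n} 2≤c (c≤fib[1+ns+o] o) r<c eq′
  ...   | a , s , a+s≡m′ , c≡Ls , r≡Fa = begin
    3 + ns + o  ≡⟨ a+s≡m′ ⟨
    a + s       ≤⟨ <⇒≤ (+-mono-≤-< a≤ns s<j) ⟩
    ns + j      ∎
    where
    a≤ns : a ≤ ns
    a≤ns = ns-max a (<⇒≤pred (subst (_< B) r≡Fa (<-≤-trans r<c c≤B)))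
    s<j : s < j
    s<j = lucas-<⇒< (≤-trans (s≤s z≤n) 2≤j) (subst (_< lucas j) c≡Ls (≤-<-trans c≤B B<Lj))

2≤m^n : ∀ {m n} → 2 ≤ m → 1 ≤ n → 2 ≤ m ^ n
2≤m^n {m} {suc n} 2≤m _ = *-mono-≤ 2≤m (m^n>0 m n)
  where
  instance
    m≢0 : NonZero m
    m≢0 = >-nonZero (≤-trans (s≤s z≤n) 2≤m)

append-step-index-< : ∀ {b N m n} → 2 ≤ b → 1 ≤ m → AppendStep b N (fib m) (fib n) → m < n
append-step-index-< {m = m} 2≤b 1≤m (t , 1≤t , _ , r , _ , eq) =
  fib-<⇒< (subst (fib m <_) (sym eq) (<-*-+ r (2≤m^n 2≤b 1≤t) (fib-mono {1} 1≤m)))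

append-step-index-≤ : ∀ {b N ns j m n} → 2 ≤ b → (∀ x → fib x ≤ b ^ N ∸ 1 → x ≤ ns) →
                      b ^ N < lucas j → AppendStep b N (fib m) (fib n) → m ≤ ns + j
append-step-index-≤ {b} {n = n} 2≤b ns-max B<Lj (t , 1≤t , t≤N , r , r<bᵗ , eq) =
  fib-append-index-≤ {n = n} ns-max B<Lj (2≤m^n 2≤b 1≤t) (^-monoʳ-≤ b t≤N) r<bᵗ eq
  where
  instance
    b≢0 : NonZero b
    b≢0 = >-nonZero (≤-trans (s≤s z≤n) 2≤b)

walk-index : ∀ {b N M k} → 2 ≤ b → IsWalk b N M k → ∀ i → i ≤ k → ∃ λ n → i < n × M i ≡ fib n
walk-index 2≤b ((m , 1≤m , M₀≡Fm) , _) zero _ = m , 1≤m , M₀≡Fm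
walk-index {b} {N} 2≤b walk@(_ , fibs , steps) (suc i) 1+i≤k
  with walk-index 2≤b walk i (<⇒≤ 1+i≤k) | fibs (suc i) 1+i≤k
... | n , i<n , Mi≡Fn | n′ , Fn′≡Mi+1 =
  n′ , ≤-<-trans i<n (append-step-index-< 2≤b (≤-trans (s≤s z≤n) i<n) step) , sym Fn′≡Mi+1
  where
  step : AppendStep b N (fib n) (fib n′)
  step = subst₂ (AppendStep b N) Mi≡Fn (sym Fn′≡Mi+1) (steps i 1+i≤k)

walk-length-≤ : ∀ {b N T M k} → 2 ≤ b →
                (∀ m → T + 1 ≤ m → ¬ ∃ λ n → AppendStep b N (fib m) (fib n)) →
                IsWalk b N M k → k ≤ T
walk-length-≤ {b} {N} {T} {k = k} 2≤b no-step walk@(_ , fibs , steps) = ≮⇒≥ last-step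
  where
  last-step : T < k → ⊥
  last-step T<k with walk-index 2≤b walk T (<⇒≤ T<k) | fibs (suc T) T<k
  ... | n , T<n , MT≡Fn | n′ , Fn′≡MT+1 =
    no-step n (subst (_≤ n) (+-comm 1 T) T<n)
      (n′ , subst₂ (AppendStep b N) MT≡Fn (sym Fn′≡MT+1) (steps T T<k))

square : ∀ x → x ^ 2 ≡ x * x
square x = cong (x *_) (*-identityʳ x)

lucas-pos : ∀ n → 1 ≤ lucas n
lucas-pos zero = s≤s z≤n
lucas-pos (suc zero) = s≤s z≤n
lucas-pos (suc (suc n)) = ≤-trans (lucas-pos (suc n)) (m≤m+n (lucas (suc n)) (lucas n))

-- √5 F_n < L_n + 2, i.e. φ^n < L_n + 1.
5*fib²<[lucas+2]² : ∀ n → 5 * (fib n * fib n) < (lucas n + 2) * (lucas n + 2)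
5*fib²<[lucas+2]² n = begin-strict
  5 * (fib n * fib n)        ≤⟨ ±⇒≤ (lucas-cassini n) ⟩
  L * L + 4                  <⟨ m<m+n (L * L + 4) (≤-trans (s≤s z≤n) (*-monoʳ-≤ 4 (lucas-pos n))) ⟩
  L * L + 4 + 4 * L          ≡⟨ expand L ⟩
  (L + 2) * (L + 2)          ∎
  where
  open ≤-Reasoning
  L : ℕ
  L = lucas n
  expand : ∀ l → l * l + 4 + 4 * l ≡ (l + 2) * (l + 2)
  expand = solve-∀

phiPowLe-lucas : ∀ n → PhiPowLe n (lucas n + 1)
phiPowLe-lucas n = ≤-trans (m≤n+m L (L + 2)) (≤-reflexive (sym (double L))) , 5F²≤X²
  where
  open ≤-Reasoning
  L : ℕ
  L = lucas n
  double : ∀ l → 2 * (l + 1) ≡ (l + 2) + l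
  double = solve-∀
  5F²≤X² : 5 * fib n ^ 2 ≤ (2 * (L + 1) ∸ L) ^ 2
  5F²≤X² = begin
    5 * fib n ^ 2          ≡⟨ cong (5 *_) (square (fib n)) ⟩
    5 * (fib n * fib n)    ≤⟨ <⇒≤ (5*fib²<[lucas+2]² n) ⟩
    (L + 2) * (L + 2)      ≡⟨ square (L + 2) ⟨
    (L + 2) ^ 2            ≡⟨ cong (_^ 2) (m+n∸n≡m (L + 2) L) ⟨
    ((L + 2) + L ∸ L) ^ 2  ≡⟨ cong (λ x → (x ∸ L) ^ 2) (double L) ⟨
    (2 * (L + 1) ∸ L) ^ 2  ∎

phiPowLe-mono : ∀ n {M M′} → M ≤ M′ → PhiPowLe n M → PhiPowLe n M′
phiPowLe-mono n {M} {M′} M≤M′ (L≤2M , φⁿ≤M) =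
  ≤-trans L≤2M 2M≤2M′ , ≤-trans φⁿ≤M (^-monoˡ-≤ 2 (∸-monoˡ-≤ (lucas n) 2M≤2M′))
  where
  2M≤2M′ : 2 * M ≤ 2 * M′
  2M≤2M′ = *-monoʳ-≤ 2 M≤M′

phiPowGe⇒≤lucas : ∀ n {M} → PhiPowGe n M → M ≤ lucas n
phiPowGe⇒≤lucas n {M} M≤φⁿ = ≮⇒≥ (λ L<M → <⇒≱ (5*fib²<[lucas+2]² n) (too-big L<M))
  where
  open ≤-Reasoning
  L : ℕ
  L = lucas n
  double : ∀ l → (l + 2) + l ≡ 2 * (1 + l)
  double = solve-∀
  too-big : L < M → (L + 2) * (L + 2) ≤ 5 * (fib n * fib n)
  too-big L<M = begin
    (L + 2) * (L + 2)         ≤⟨ *-mono-≤ L+2≤X L+2≤X ⟩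
    (2 * M ∸ L) * (2 * M ∸ L) ≡⟨ square (2 * M ∸ L) ⟨
    (2 * M ∸ L) ^ 2           ≤⟨ M≤φⁿ ⟩
    5 * fib n ^ 2             ≡⟨ cong (5 *_) (square (fib n)) ⟩
    5 * (fib n * fib n)       ∎
    where
    L+2≤X : L + 2 ≤ 2 * M ∸ L
    L+2≤X = m+n≤o⇒m≤o∸n (L + 2) (≤-trans (≤-reflexive (double L)) (*-monoʳ-≤ 2 L<M))

¬phiPowGe⇒lucas≤ : ∀ n {M} → 1 ≤ M → ¬ PhiPowGe n M → lucas n ≤ M
¬phiPowGe⇒lucas≤ n {M} 1≤M M≰φⁿ = ≮⇒≥ (λ M<L → M≰φⁿ (M≤φⁿ M<L))
  where
  open ≤-Reasoning
  L : ℕ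
  L = lucas n
  expand : ∀ y → y * y + 4 + 4 * y ≡ (y + 2) * (y + 2)
  expand = solve-∀
  shift : ∀ m → 2 * m + 2 ≡ 2 * (1 + m)
  shift = solve-∀
  regroup : ∀ y → y + 2 + y + 2 ≡ 2 * (y + 2)
  regroup = solve-∀
  M≤φⁿ : M < L → PhiPowGe n M
  M≤φⁿ M<L = begin
    (2 * M ∸ L) ^ 2      ≤⟨ ^-monoˡ-≤ 2 X≤y ⟩
    y ^ 2                ≡⟨ square y ⟩
    y * y                ≤⟨ +-cancelʳ-≤ 4 (y * y) (5 * (fib n * fib n)) y²+4≤5F²+4 ⟩
    5 * (fib n * fib n)  ≡⟨ cong (5 *_) (square (fib n)) ⟨
    5 * fib n ^ 2        ∎
    where
    y : ℕ
    y = L ∸ 2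
    L≡y+2 : L ≡ y + 2
    L≡y+2 = sym (m∸n+n≡m (≤-<-trans 1≤M M<L))
    X≤y : 2 * M ∸ L ≤ y
    X≤y = m≤n+o⇒m∸n≤o (2 * M) L (+-cancelʳ-≤ 2 (2 * M) (L + y) (begin
      2 * M + 2      ≡⟨ shift M ⟩
      2 * (1 + M)    ≤⟨ *-monoʳ-≤ 2 M<L ⟩
      2 * L          ≡⟨ cong (2 *_) L≡y+2 ⟩
      2 * (y + 2)    ≡⟨ regroup y ⟨
      y + 2 + y + 2  ≡⟨ cong (λ l → l + y + 2) L≡y+2 ⟨
      L + y + 2      ∎))
    y²+4≤5F²+4 : y * y + 4 ≤ 5 * (fib n * fib n) + 4
    y²+4≤5F²+4 = begin
      y * y + 4                ≤⟨ m≤m+n (y * y + 4) (4 * y) ⟩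
      y * y + 4 + 4 * y        ≡⟨ expand y ⟩
      (y + 2) * (y + 2)        ≡⟨ cong (λ l → l * l) L≡y+2 ⟨
      L * L                    ≤⟨ ±⇒≥ (lucas-cassini n) ⟩
      5 * (fib n * fib n) + 4  ∎

lucas-+-≤ : ∀ {X} p q → lucas q ≤ X → lucas (suc q) ≤ X →
            lucas (suc (p + q)) ≤ fib (suc (suc p)) * X
lucas-+-≤ {X} p q Lq≤X Lq+1≤X = begin
  lucas (suc (p + q))                            ≡⟨ fibLike-addition lucas lucas-fibLike p q ⟩
  fib (suc p) * lucas (suc q) + fib p * lucas q  ≤⟨ +-mono-≤ (*-monoʳ-≤ (fib (suc p)) Lq+1≤X)
                                                              (*-monoʳ-≤ (fib p) Lq≤X) ⟩
  fib (suc p) * X + fib p * X                    ≡⟨ *-distribʳ-+ X (fib (suc p)) (fib p) ⟨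
  fib (suc (suc p)) * X                          ∎
  where open ≤-Reasoning

phiPowLe-2B² : ∀ {B ns j} → 2 ≤ ns → 2 ≤ j → fib ns ≤ B ∸ 1 → (∀ i → i < j → lucas i ≤ 2 * B) →
               PhiPowLe (ns + suc j ∸ 4) (2 * B ^ 2)
phiPowLe-2B² {zero} {suc (suc p)} (s≤s (s≤s z≤n)) (s≤s (s≤s z≤n)) Fns≤0 _ =
  contradiction (≤-trans (fib-suc-pos (suc p)) Fns≤0) λ ()
phiPowLe-2B² {suc B} {suc (suc p)} {suc (suc q)} (s≤s (s≤s z≤n)) (s≤s (s≤s z≤n)) Fns≤B Lᵢ≤2B =
  subst (λ e → PhiPowLe e (2 * suc B ^ 2)) index
        (phiPowLe-mono (suc (p + q)) L+1≤2B² (phiPowLe-lucas (suc (p + q))))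
  where
  open ≤-Reasoning
  index : suc (p + q) ≡ suc (suc p) + suc (suc (suc q)) ∸ 4
  index = cong (_∸ 2) (sym (trans (+-suc p _) (cong suc (trans (+-suc p _) (cong suc (+-suc p q))))))
  Lq≤2B : lucas q ≤ 2 * suc B
  Lq≤2B = Lᵢ≤2B q (<-trans (n<1+n q) (n<1+n (suc q)))
  regroup : ∀ b → b * (2 * (1 + b)) + 2 * (1 + b) ≡ 2 * ((1 + b) * (1 + b))
  regroup = solve-∀
  L+1≤2B² : lucas (suc (p + q)) + 1 ≤ 2 * suc B ^ 2
  L+1≤2B² = begin
    lucas (suc (p + q)) + 1              ≤⟨ +-monoˡ-≤ 1 (lucas-+-≤ p q Lq≤2B (Lᵢ≤2B (suc q) ≤-refl)) ⟩
    fib (suc (suc p)) * (2 * suc B) + 1  ≤⟨ +-mono-≤ (*-monoˡ-≤ (2 * suc B) Fns≤B) (s≤s z≤n) ⟩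
    B * (2 * suc B) + 2 * suc B          ≡⟨ regroup B ⟩
    2 * (suc B * suc B)                  ≡⟨ cong (2 *_) (square (suc B)) ⟨
    2 * suc B ^ 2                        ∎

theorem3p1 : (b N : ℕ) → 2 ≤ b → 1 ≤ N → (K ns : ℕ) → IsK b N K → IsNStar b N ns →
    ((m : ℕ) → ns + K + 1 ≤ m →
      ¬ (∃ λ n → ∃ λ t → 1 ≤ t × t ≤ N × (∃ λ r → r < b ^ t × fib n ≡ b ^ t * fib m + r)))
    × ((M : ℕ → ℕ) → (k : ℕ) → IsWalk b N M k → k ≤ ns + K)
    × PhiPowLe (ns + K ∸ 4) (2 * b ^ (2 * N))
theorem3p1 b N 2≤b 1≤N .(suc j) ns (j , refl , φʲ≥2bᴺ , φⁱ<2bᴺ) (Fns≤bᴺ-1 , ns-max) =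
  no-step , (λ _ _ → walk-length-≤ 2≤b no-step) , subst (PhiPowLe (ns + suc j ∸ 4)) 2bᴺ²≡2b²ᴺ φ-bound
  where
  B : ℕ
  B = b ^ N
  2≤B : 2 ≤ B
  2≤B = 2≤m^n 2≤b 1≤N
  1≤B : 1 ≤ B
  1≤B = ≤-trans (s≤s z≤n) 2≤B
  B<Lj : B < lucas j
  B<Lj = <-≤-trans (m<m+n B (≤-trans 1≤B (m≤m+n B 0))) (phiPowGe⇒≤lucas j φʲ≥2bᴺ)
  no-step : ∀ m → ns + suc j + 1 ≤ m → ¬ ∃ λ n → AppendStep b N (fib m) (fib n)
  no-step m ns+j+2≤m (n , step) =
    <⇒≱ (<-≤-trans (≤-trans (+-monoʳ-< ns (n<1+n j)) (m≤m+n (ns + suc j) 1)) ns+j+2≤m)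
        (append-step-index-≤ {m = m} {n = n} 2≤b ns-max B<Lj step)
  φ-bound : PhiPowLe (ns + suc j ∸ 4) (2 * B ^ 2)
  φ-bound = phiPowLe-2B² {B} (ns-max 2 (m+n≤o⇒m≤o∸n 1 2≤B)) (2<lucas⇒2≤ (≤-<-trans 2≤B B<Lj)) Fns≤bᴺ-1
              (λ i i<j → ¬phiPowGe⇒lucas≤ i (≤-trans 1≤B (m≤m+n B _)) (φⁱ<2bᴺ i i<j))
  2bᴺ²≡2b²ᴺ : 2 * B ^ 2 ≡ 2 * b ^ (2 * N)
  2bᴺ²≡2b²ᴺ = cong (2 *_) (trans (^-*-assoc b N 2) (cong (b ^_) (*-comm N 2)))
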